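{- For $n\geq 5$, in the Waiter-Client game on $K_n$, Waiter can force Client to build a red Hamilton path on $K_n$ within $n-1$ rounds and such that one of the endpoints of this path is incident with at most two blue edges.
   Context: The unbiased Waiter-Client game on $K_n$: in each round Waiter offers Client two previously unclaimed (free) edges of $K_n$; Client chooses one of them, which becomes red (Client's), and the other becomes blue (Waiter's). Waiter "forces" a graph within $t$ rounds if she has a strategy guaranteeing that after at most $t$ rounds the red graph contains it. -}

module Defs where

open import Data.Nat using (ℕ; zero; suc; _≤_)
open import Data.Fin using (Fin; toℕ; _≟_)
open import Data.Product using (_×_; _,_; proj₁; proj₂; ∃)
open import Data.Sum using (_⊎_)
open import Data.List using (List; []; _∷_; length; filter)
open import Data.List.Relation.Unary.Any using (Any)
open import Relation.Nullary using (¬_; _⊎-dec_)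
open import Relation.Binary.PropositionalEquality using (_≡_; _≢_)
open import Function.Definitions using (Injective)

-- A (potential) edge of K_n, given by its two endpoints (unordered reading
-- via SameEdge).
Edge : ℕ → Set
Edge n = Fin n × Fin n

SameEdge : ∀ {n} → Edge n → Edge n → Set
SameEdge (a , b) (c , d) = (a ≡ c × b ≡ d) ⊎ (a ≡ d × b ≡ c)

-- One round: (red edge chosen by Client , blue edge given to Waiter).
Round : ℕ → Set
Round n = Edge n × Edge n

-- Game history, most recent round first.
History : ℕ → Set
History n = List (Round n)

Claimed : ∀ {n} → History n → Edge n → Set
Claimed h e = Any (λ r → SameEdge (proj₁ r) e ⊎ SameEdge (proj₂ r) e) h

Free : ∀ {n} → History n → Edge n → Set
Free h e = (proj₁ e ≢ proj₂ e) × ¬ Claimed h e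

Red : ∀ {n} → History n → Fin n → Fin n → Set
Red h u v = Any (λ r → SameEdge (proj₁ r) (u , v)) h

blueDeg : ∀ {n} → History n → Fin n → ℕ
blueDeg h v = length (filter (λ r → (proj₁ (proj₂ r) ≟ v) ⊎-dec (proj₂ (proj₂ r) ≟ v)) h)

Goal : ∀ {n} → History n → Set
Goal {n} h = ∃ λ (p : Fin n → Fin n) →
  Injective _≡_ _≡_ p ×
  (∀ (i j : Fin n) → toℕ j ≡ suc (toℕ i) → Red h (p i) (p j)) ×
  ∃ λ (i : Fin n) → (toℕ i ≡ 0 ⊎ suc (toℕ i) ≡ n) × blueDeg h (p i) ≤ 2

-- Forces k h : from position h, Waiter has a strategy guaranteeing that
-- within at most k further rounds the Goal holds.
-- In a round Waiter offers two distinct free edges e, f; Client picks one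
-- (red), the other becomes blue.
data Forces {n : ℕ} : ℕ → History n → Set where
  done : ∀ {k h} → Goal h → Forces k h
  step : ∀ {k h} (e f : Edge n) → Free h e → Free h f → ¬ SameEdge e f →
         Forces k ((e , f) ∷ h) → Forces k ((f , e) ∷ h) → Forces (suc k) h

{-# OPTIONS --safe #-}
module Submission where

-- Waiter first offers c q₁, c q₂ and then c p₁, c p₂. Client's red edges form
-- a path p c q and both blue edges join c to the other two offered vertices,
-- so every vertex off the path has at most one blue edge, and all its claimed
-- edges go to c, an interior vertex of the path. Waiter then repeatedly picks
-- a vertex x off the red path with ends a and b and offers a x and b x: both
-- are free because a, b ≠ c, and whichever Client takes, the path grows by x,
-- which becomes an end. So the last vertex added has at most one blue edge
-- from before plus the one from the round that added it, and the game takes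
-- 2 + (n - 3) = n - 1 rounds.

open import Defs
open import Data.Nat using (ℕ; suc; _≤_; _∸_; _+_; s≤s)
open import Data.Nat.Properties using (≤-trans; ≤-reflexive; suc-injective)
open import Data.Fin using (Fin; zero; suc; toℕ; cast; _≟_)
open import Data.Fin.Properties using (toℕ-cast; toℕ-injective; cast-involutive)
open import Data.List using (List; []; _∷_; _++_; _∷ʳ_; length; lookup; reverse; allFin)
open import Data.List.Properties
  using (++-identityʳ; unfold-reverse; length-tabulate; length-filter; filter-accept; filter-reject)
open import Data.List.Relation.Unary.Any as Any using (here; there)
open import Data.List.Relation.Unary.All as All using (_∷_)
open import Data.List.Relation.Unary.All.Properties using (All¬⇒¬Any)
open import Data.List.Relation.Unary.AllPairs using (_∷_)
open import Data.List.Relation.Unary.Linked using (Linked; [-]; _∷_)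
open import Data.List.Relation.Unary.Unique.Propositional as Unique using (Unique)
open import Data.List.Relation.Unary.Unique.Propositional.Properties using (allFin⁺; Unique[x∷xs]⇒x∉xs)
open import Data.List.Relation.Binary.Disjoint.Propositional using (Disjoint)
open import Data.List.Relation.Binary.Permutation.Propositional
  using (_↭_; ↭-refl; ↭-sym; ↭-trans; prep; swap; ↭⇒↭ₛ)
open import Data.List.Relation.Binary.Permutation.Propositional.Properties
  using (↭-length; ↭-reverse; ++⁺ʳ; shift)
import Data.List.Relation.Binary.Permutation.Setoid.Properties as Permutationₛ
open import Data.List.Membership.Propositional using (_∈_; _∉_)
open import Data.List.Membership.Propositional.Properties using (∈-lookup; ∈-++⁺ˡ; ∈-++⁺ʳ)
open import Data.Product using (_,_; proj₁; proj₂)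
open import Data.Sum using (_⊎_; inj₁; inj₂; [_,_])
open import Data.Empty using (⊥-elim)
open import Function using (id; _∘_)
open import Function.Definitions using (Injective)
open import Level using (Level)
open import Relation.Nullary using (¬_; Dec; yes; no; _⊎-dec_)
open import Relation.Binary.Core using (Rel)
open import Relation.Binary.PropositionalEquality
  using (_≡_; _≢_; refl; sym; trans; cong; subst; setoid; module ≡-Reasoning)

private variable
  ℓ : Level
  A : Set
  m n : ℕ

cast-injective : .(eq : m ≡ n) → Injective _≡_ _≡_ (cast eq)
cast-injective eq {i} {j} cast-i≡cast-j = toℕ-injective (begin
  toℕ i          ≡⟨ toℕ-cast eq i ⟨
  toℕ (cast eq i) ≡⟨ cong toℕ cast-i≡cast-j ⟩
  toℕ (cast eq j) ≡⟨ toℕ-cast eq j ⟩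
  toℕ j          ∎)
  where open ≡-Reasoning

∈∧∉⇒≢ : {x y : A} {xs : List A} → x ∈ xs → y ∉ xs → x ≢ y
∈∧∉⇒≢ x∈xs y∉xs refl = y∉xs x∈xs

Unique-resp-↭ : {xs ys : List A} → xs ↭ ys → Unique xs → Unique ys
Unique-resp-↭ {A} xs↭ys = Permutationₛ.Unique-resp-↭ (setoid A) (↭⇒↭ₛ xs↭ys)

Unique[xs++ys]⇒Disjoint : (xs : List A) {ys : List A} → Unique (xs ++ ys) → Disjoint xs ys
Unique[xs++ys]⇒Disjoint (x ∷ xs) (x∉ ∷ _) (here refl , y∈ys) = All.lookup x∉ (∈-++⁺ʳ xs y∈ys) refl
Unique[xs++ys]⇒Disjoint (x ∷ xs) (_ ∷ u) (there y∈xs , y∈ys) =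
  Unique[xs++ys]⇒Disjoint xs u (y∈xs , y∈ys)

Unique⇒lookup-injective : {xs : List A} → Unique xs → Injective _≡_ _≡_ (lookup xs)
Unique⇒lookup-injective (_ ∷ _)   {zero}  {zero}  _  = refl
Unique⇒lookup-injective (x∉ ∷ _)  {zero}  {suc j} eq = ⊥-elim (All.lookup x∉ (∈-lookup j) eq)
Unique⇒lookup-injective (x∉ ∷ _)  {suc i} {zero}  eq = ⊥-elim (All.lookup x∉ (∈-lookup i) (sym eq))
Unique⇒lookup-injective (_ ∷ u)   {suc i} {suc j} eq = cong suc (Unique⇒lookup-injective u eq)

Linked-lookup : {R : Rel A ℓ} {xs : List A} → Linked R xs →
                ∀ i j → toℕ j ≡ suc (toℕ i) → R (lookup xs i) (lookup xs j)
Linked-lookup (r ∷ _) zero    (suc zero)    _  = r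
Linked-lookup (_ ∷ l) (suc i) (suc j)       eq = Linked-lookup l i j (suc-injective eq)
Linked-lookup (_ ∷ _) zero    (suc (suc _)) ()
Linked-lookup (_ ∷ _) _       zero          ()
Linked-lookup [-]     zero    zero          ()

enumeration-unique : {xs : List (Fin n)} → xs ↭ allFin n → Unique xs
enumeration-unique xs↭ = Unique-resp-↭ (↭-sym xs↭) (allFin⁺ _)

enumeration-length : {xs : List (Fin n)} → xs ↭ allFin n → length xs ≡ n
enumeration-length xs↭ = trans (↭-length xs↭) (length-tabulate id)

SameEdge-swap : {e : Edge n} {u v : Fin n} → SameEdge e (u , v) → SameEdge e (v , u)
SameEdge-swap (inj₁ (p , q)) = inj₂ (p , q)
SameEdge-swap (inj₂ (p , q)) = inj₁ (p , q)

SameEdge-cancelˡ : {c u v : Fin n} → SameEdge (c , u) (c , v) → u ≡ v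
SameEdge-cancelˡ (inj₁ (_ , u≡v))   = u≡v
SameEdge-cancelˡ (inj₂ (c≡v , u≡c)) = trans u≡c c≡v

SameEdge-anchored : {c t v y : Fin n} → c ≢ y → SameEdge (c , t) (v , y) → v ≡ c
SameEdge-anchored _   (inj₁ (c≡v , _)) = sym c≡v
SameEdge-anchored c≢y (inj₂ (c≡y , _)) = ⊥-elim (c≢y c≡y)

Red-sym : {h : History n} {u v : Fin n} → Red h u v → Red h v u
Red-sym = Any.map SameEdge-swap

blueDeg≤length : (h : History n) (v : Fin n) → blueDeg h v ≤ length h
blueDeg≤length h v = length-filter _ h

blue-incident? : (v : Fin n) (r : Round n) → Dec (proj₁ (proj₂ r) ≡ v ⊎ proj₂ (proj₂ r) ≡ v)
blue-incident? v r = (proj₁ (proj₂ r) ≟ v) ⊎-dec (proj₂ (proj₂ r) ≟ v)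

blueDeg-∷-incident : (e : Edge n) (u v : Fin n) (h : History n) →
                     blueDeg ((e , (u , v)) ∷ h) v ≡ suc (blueDeg h v)
blueDeg-∷-incident e u v h =
  cong length (filter-accept (blue-incident? v) {e , (u , v)} {h} (inj₂ refl))

blueDeg-∷-nonincident : (e : Edge n) {u w v : Fin n} (h : History n) → u ≢ v → w ≢ v →
                        blueDeg ((e , (u , w)) ∷ h) v ≡ blueDeg h v
blueDeg-∷-nonincident e {u} {w} {v} h u≢v w≢v =
  cong length (filter-reject (blue-incident? v) {e , (u , w)} {h} [ u≢v , w≢v ])

data RedPath (h : History n) : Fin n → Fin n → List (Fin n) → Set where
  [_] : ∀ a → RedPath h a a (a ∷ [])
  _∷_ : ∀ {x a b ps} → Red h x a → RedPath h a b ps → RedPath h x b (x ∷ ps)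

module _ {h : History n} where

  RedPath-head∈ : ∀ {a b ps} → RedPath h a b ps → a ∈ ps
  RedPath-head∈ [ _ ]   = here refl
  RedPath-head∈ (_ ∷ _) = here refl

  RedPath-last∈ : ∀ {a b ps} → RedPath h a b ps → b ∈ ps
  RedPath-last∈ [ _ ]   = here refl
  RedPath-last∈ (_ ∷ p) = there (RedPath-last∈ p)

  RedPath-weaken : ∀ {a b ps} (r : Round n) → RedPath h a b ps → RedPath (r ∷ h) a b ps
  RedPath-weaken r [ a ]   = [ a ]
  RedPath-weaken r (x ∷ p) = there x ∷ RedPath-weaken r p

  RedPath-∷ʳ : ∀ {a b y ps} → RedPath h a b ps → Red h b y → RedPath h a y (ps ∷ʳ y)
  RedPath-∷ʳ [ a ]    b-y = b-y ∷ [ _ ]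
  RedPath-∷ʳ (x-a ∷ p) b-y = x-a ∷ RedPath-∷ʳ p b-y

  RedPath-reverse : ∀ {a b ps} → RedPath h a b ps → RedPath h b a (reverse ps)
  RedPath-reverse [ a ] = [ a ]
  RedPath-reverse {ps = x ∷ ps} (x-a ∷ p) =
    subst (RedPath h _ _) (sym (unfold-reverse x ps)) (RedPath-∷ʳ (RedPath-reverse p) (Red-sym x-a))

  RedPath⇒Linked : ∀ {a b ps} → RedPath h a b ps → Linked (Red h) ps
  RedPath⇒Linked [ _ ]             = [-]
  RedPath⇒Linked (x-a ∷ [ _ ])     = x-a ∷ [-]
  RedPath⇒Linked (x-a ∷ p@(_ ∷ _)) = x-a ∷ RedPath⇒Linked p

  HamiltonPath⇒Goal : ∀ {a ps} → Linked (Red h) (a ∷ ps) → a ∷ ps ↭ allFin n →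
                      blueDeg h a ≤ 2 → Goal h
  HamiltonPath⇒Goal {a} {ps} linked enum a-blueDeg =
    vertex , vertex-injective , vertex-red , cast len zero , inj₁ (toℕ-cast len zero) ,
    subst (λ v → blueDeg h v ≤ 2) (sym vertex-first) a-blueDeg
    where
      len : length (a ∷ ps) ≡ n
      len = enumeration-length enum

      vertex : Fin n → Fin n
      vertex = lookup (a ∷ ps) ∘ cast (sym len)

      vertex-injective : Injective _≡_ _≡_ vertex
      vertex-injective = cast-injective (sym len) ∘ Unique⇒lookup-injective (enumeration-unique enum)

      vertex-red : ∀ i j → toℕ j ≡ suc (toℕ i) → Red h (vertex i) (vertex j)
      vertex-red i j j≡1+i = Linked-lookup linked (cast _ i) (cast _ j)
        (trans (toℕ-cast _ j) (trans j≡1+i (cong suc (sym (toℕ-cast _ i)))))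

      vertex-first : vertex (cast len zero) ≡ a
      vertex-first = cong (lookup (a ∷ ps)) (cast-involutive (sym len) len zero)

  RedPath⇒Goal : ∀ {a b ps} → RedPath h a b ps → ps ↭ allFin n → blueDeg h a ≤ 2 → Goal h
  RedPath⇒Goal p@([ _ ]) = HamiltonPath⇒Goal (RedPath⇒Linked p)
  RedPath⇒Goal p@(_ ∷ _) = HamiltonPath⇒Goal (RedPath⇒Linked p)

-- A position of the extension phase: ps are the vertices of the red a–b
-- path, fs those still to be added, and c the centre of the opening.
record Extendable (c : Fin n) (h : History n) (a b : Fin n) (ps fs : List (Fin n)) : Set where
  field
    path          : RedPath h a b ps
    vertices      : ps ++ fs ↭ allFin n
    a≢b           : a ≢ b
    c≢a           : c ≢ a
    c≢b           : c ≢ b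
    c∉fs          : c ∉ fs
    claimed-fresh : ∀ {v y} → y ∈ fs → Claimed h (v , y) → v ≡ c
    blueDeg-fresh : ∀ {y} → y ∈ fs → blueDeg h y ≤ 1

module _ {c : Fin n} {h : History n} where

  Extendable-reverse : ∀ {a b ps fs} → Extendable c h a b ps fs → Extendable c h b a (reverse ps) fs
  Extendable-reverse {ps = ps} {fs} E = record
    { path          = RedPath-reverse path
    ; vertices      = ↭-trans (++⁺ʳ fs (↭-reverse ps)) vertices
    ; a≢b           = a≢b ∘ sym
    ; c≢a           = c≢b
    ; c≢b           = c≢a
    ; c∉fs          = c∉fs
    ; claimed-fresh = claimed-fresh
    ; blueDeg-fresh = blueDeg-fresh
    }
    where open Extendable E

  module Extension {a b x ps fs} (E : Extendable c h a b ps (x ∷ fs)) where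
    open Extendable E

    private
      distinct : Unique (x ∷ ps ++ fs)
      distinct = Unique-resp-↭ (shift x ps fs) (enumeration-unique vertices)

      x∉ps : x ∉ ps
      x∉ps = Unique[x∷xs]⇒x∉xs distinct ∘ ∈-++⁺ˡ

      x∉fs : x ∉ fs
      x∉fs = Unique[x∷xs]⇒x∉xs distinct ∘ ∈-++⁺ʳ ps

      ps∩fs : Disjoint ps fs
      ps∩fs = Unique[xs++ys]⇒Disjoint ps (Unique.tail distinct)

      path≢fresh : ∀ {u y} → u ∈ ps → y ∈ fs → u ≢ y
      path≢fresh u∈ps y∈fs u≡y = ps∩fs (subst (_∈ ps) u≡y u∈ps , y∈fs)

      x≢fresh : ∀ {y} → y ∈ fs → x ≢ y
      x≢fresh y∈fs = ∈∧∉⇒≢ y∈fs x∉fs ∘ sym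

      misses-fresh : ∀ {u v y} → u ∈ ps → y ∈ fs → ¬ SameEdge (u , x) (v , y)
      misses-fresh _    y∈fs (inj₁ (_ , x≡y)) = x≢fresh y∈fs x≡y
      misses-fresh u∈ps y∈fs (inj₂ (u≡y , _)) = path≢fresh u∈ps y∈fs u≡y

    fresh-edge-free : ∀ {u} → u ∈ ps → c ≢ u → Free h (u , x)
    fresh-edge-free u∈ps c≢u = ∈∧∉⇒≢ u∈ps x∉ps , λ u-x → c≢u (sym (claimed-fresh (here refl) u-x))

    offers-distinct : ¬ SameEdge (a , x) (b , x)
    offers-distinct (inj₁ (a≡b , _)) = a≢b a≡b
    offers-distinct (inj₂ (a≡x , _)) = ∈∧∉⇒≢ (RedPath-head∈ path) x∉ps a≡x

    extend : Extendable c (((a , x) , (b , x)) ∷ h) x b (x ∷ ps) fs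
    extend = record
      { path          = here (inj₂ (refl , refl)) ∷ RedPath-weaken _ path
      ; vertices      = ↭-trans (↭-sym (shift x ps fs)) vertices
      ; a≢b           = ∈∧∉⇒≢ (RedPath-last∈ path) x∉ps ∘ sym
      ; c≢a           = c∉fs ∘ here
      ; c≢b           = c≢b
      ; c∉fs          = c∉fs ∘ there
      ; claimed-fresh = claimed-fresh′
      ; blueDeg-fresh = λ y∈fs → ≤-trans
          (≤-reflexive
            (blueDeg-∷-nonincident _ h (path≢fresh (RedPath-last∈ path) y∈fs) (x≢fresh y∈fs)))
          (blueDeg-fresh (there y∈fs))
      }
      where
        claimed-fresh′ : ∀ {v y} → y ∈ fs → Claimed (((a , x) , (b , x)) ∷ h) (v , y) → v ≡ c
        claimed-fresh′ y∈fs (here (inj₁ a-x)) = ⊥-elim (misses-fresh (RedPath-head∈ path) y∈fs a-x)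
        claimed-fresh′ y∈fs (here (inj₂ b-x)) = ⊥-elim (misses-fresh (RedPath-last∈ path) y∈fs b-x)
        claimed-fresh′ y∈fs (there y-claimed) = claimed-fresh (there y∈fs) y-claimed

    extend-blueDeg : blueDeg (((a , x) , (b , x)) ∷ h) x ≤ 2
    extend-blueDeg =
      ≤-trans (≤-reflexive (blueDeg-∷-incident _ b x h)) (s≤s (blueDeg-fresh (here refl)))

-- The bound on the blue degree of the end a is kept out of Extendable, which
-- is symmetric in a and b (Extendable-reverse).
extension-strategy : ∀ {c : Fin n} {h a b ps fs} → Extendable c h a b ps fs → blueDeg h a ≤ 2 →
                     Forces (length fs) h
extension-strategy {fs = []} E a-blueDeg =
  done (RedPath⇒Goal path (subst (_↭ allFin _) (++-identityʳ _) vertices) a-blueDeg)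
  where open Extendable E
extension-strategy {c = c} {h} {a} {b} {ps} {x ∷ fs} E _ =
  step (a , x) (b , x)
    (fresh-edge-free (RedPath-head∈ path) c≢a) (fresh-edge-free (RedPath-last∈ path) c≢b)
    offers-distinct
    (extension-strategy extend extend-blueDeg)
    (extension-strategy (Extension.extend Eʳ) (Extension.extend-blueDeg Eʳ))
  where
    open Extendable E
    open Extension E

    Eʳ : Extendable c h b a (reverse ps) (x ∷ fs)
    Eʳ = Extendable-reverse E

opening₁ : (c q r : Fin n) → History n
opening₁ c q r = ((c , q) , (c , r)) ∷ []

opening₂ : (c q r p s : Fin n) → History n
opening₂ c q r p s = ((c , p) , (c , s)) ∷ opening₁ c q r

module _ {c q r p s : Fin n} {rest : List (Fin n)} where

  opening-position : c ∷ q ∷ r ∷ p ∷ s ∷ rest ↭ allFin n →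
    Extendable c (opening₂ c q r p s) p q (p ∷ c ∷ q ∷ []) (r ∷ s ∷ rest)
  opening-position enum with enumeration-unique enum
  ... | (c≢q ∷ c≢r ∷ c≢p ∷ c≢s ∷ c∉rest) ∷ (q≢r ∷ q≢p ∷ _) ∷ (_ ∷ r≢s ∷ _) ∷ _ = record
    { path          = here (inj₂ (refl , refl)) ∷ there (here (inj₁ (refl , refl))) ∷ [ q ]
    ; vertices      = ↭-trans (↭-sym (shift p (c ∷ q ∷ r ∷ []) (s ∷ rest))) enum
    ; a≢b           = q≢p ∘ sym
    ; c≢a           = c≢p
    ; c≢b           = c≢q
    ; c∉fs          = c∉fs
    ; claimed-fresh = claimed-fresh
    ; blueDeg-fresh = blueDeg-fresh
    }
    where
      c∉fs : c ∉ r ∷ s ∷ rest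
      c∉fs = All¬⇒¬Any (c≢r ∷ c≢s ∷ c∉rest)

      c≢fresh : ∀ {y} → y ∈ r ∷ s ∷ rest → c ≢ y
      c≢fresh y∈fs = ∈∧∉⇒≢ y∈fs c∉fs ∘ sym

      claimed-fresh : ∀ {v y} → y ∈ r ∷ s ∷ rest → Claimed (opening₂ c q r p s) (v , y) → v ≡ c
      claimed-fresh y∈fs (here (inj₁ c-p))         = SameEdge-anchored (c≢fresh y∈fs) c-p
      claimed-fresh y∈fs (here (inj₂ c-s))         = SameEdge-anchored (c≢fresh y∈fs) c-s
      claimed-fresh y∈fs (there (here (inj₁ c-q))) = SameEdge-anchored (c≢fresh y∈fs) c-q
      claimed-fresh y∈fs (there (here (inj₂ c-r))) = SameEdge-anchored (c≢fresh y∈fs) c-r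

      blueDeg-fresh : ∀ {y} → y ∈ r ∷ s ∷ rest → blueDeg (opening₂ c q r p s) y ≤ 1
      blueDeg-fresh {y} y∈fs with y ≟ s
      ... | yes refl = ≤-reflexive (trans (blueDeg-∷-incident _ c s (opening₁ c q r))
                                          (cong suc (blueDeg-∷-nonincident _ [] c≢s r≢s)))
      ... | no y≢s   = ≤-trans
        (≤-reflexive (blueDeg-∷-nonincident _ (opening₁ c q r) (c≢fresh y∈fs) (y≢s ∘ sym)))
        (blueDeg≤length (opening₁ c q r) y)

  opening-strategy : c ∷ q ∷ r ∷ p ∷ s ∷ rest ↭ allFin n →
                     Forces (2 + length rest) (opening₂ c q r p s)
  opening-strategy enum =
    extension-strategy (opening-position enum) (blueDeg≤length (opening₂ c q r p s) p)

module _ {c q r p₁ p₂ : Fin n} {rest : List (Fin n)} where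

  second-round : c ∷ q ∷ r ∷ p₁ ∷ p₂ ∷ rest ↭ allFin n →
                 Forces (3 + length rest) (opening₁ c q r)
  second-round enum with enumeration-unique enum
  ... | (_ ∷ _ ∷ c≢p₁ ∷ c≢p₂ ∷ _) ∷ (_ ∷ q≢p₁ ∷ q≢p₂ ∷ _) ∷ (r≢p₁ ∷ r≢p₂ ∷ _) ∷ (p₁≢p₂ ∷ _) ∷ _ =
    step (c , p₁) (c , p₂) (c≢p₁ , unclaimed q≢p₁ r≢p₁) (c≢p₂ , unclaimed q≢p₂ r≢p₂)
      (p₁≢p₂ ∘ SameEdge-cancelˡ)
      (opening-strategy enum)
      (opening-strategy (↭-trans (prep c (prep q (prep r (swap p₂ p₁ ↭-refl)))) enum))
    where
      unclaimed : ∀ {v} → q ≢ v → r ≢ v → ¬ Claimed (opening₁ c q r) (c , v)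
      unclaimed q≢v _   (here (inj₁ c-q)) = q≢v (SameEdge-cancelˡ c-q)
      unclaimed _   r≢v (here (inj₂ c-r)) = r≢v (SameEdge-cancelˡ c-r)

module _ {c q₁ q₂ p₁ p₂ : Fin n} {rest : List (Fin n)} where

  first-round : c ∷ q₁ ∷ q₂ ∷ p₁ ∷ p₂ ∷ rest ↭ allFin n → Forces (4 + length rest) []
  first-round enum with enumeration-unique enum
  ... | (c≢q₁ ∷ c≢q₂ ∷ _) ∷ (q₁≢q₂ ∷ _) ∷ _ =
    step (c , q₁) (c , q₂) (c≢q₁ , λ ()) (c≢q₂ , λ ()) (q₁≢q₂ ∘ SameEdge-cancelˡ)
      (second-round enum)
      (second-round (↭-trans (prep c (swap q₂ q₁ ↭-refl)) enum))

  Goal-forced : c ∷ q₁ ∷ q₂ ∷ p₁ ∷ p₂ ∷ rest ↭ allFin n → Forces (n ∸ 1) []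
  Goal-forced enum = subst (λ k → Forces {n} (k ∸ 1) []) (enumeration-length enum) (first-round enum)

-- allFin (5 + m) computes to 0 ∷ 1 ∷ 2 ∷ 3 ∷ 4 ∷ _, which serve as c, q₁, q₂, p₁, p₂.
lemma3p1 : (n : ℕ) → 5 ≤ n → Forces {n} (n ∸ 1) []
lemma3p1 _ (s≤s (s≤s (s≤s (s≤s (s≤s _))))) = Goal-forced ↭-refl
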